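{- Let $P$ be a finite poset of dimension $2$ such that no strong copy of $P$ in a two-dimensional grid contains two neighboring points. Then for all positive integers $k,l$, $sat^*([k]\times[l],P)\ge\max\{k,l\}$.
   Context: $[k]\times[l]$ carries the coordinatewise order; two points of a two-dimensional grid are neighboring if they agree in one coordinate and differ by exactly $1$ in the other. The dimension of a finite poset $P$ is the smallest $d$ such that there are $d$ linear orders $\pi_1,\dots,\pi_d$ of $P$ with $p<_P q$ iff $\pi_i(p)<\pi_i(q)$ for all $i$. A strong copy of $P$ in a poset $R$ is the image of an injection $i:P\to R$ with $p\le_P p'\iff i(p)\le_R i(p')$. A subset $F$ of $Q$ is strong $P$-saturated if it contains no strong copy of $P$ but $F\cup\{x\}$ contains one for every $x\in Q\setminus F$; $sat^*(Q,P)$ is the minimum size of a strong $P$-saturated subset of $Q$. -}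

module Defs where

open import Level using (0ℓ)
open import Data.Nat using (ℕ; zero; suc; _<_)
open import Data.Fin using (Fin; toℕ)
import Data.Fin as F
open import Data.Product using (Σ; _×_; _,_; proj₁; proj₂)
open import Data.Sum using (_⊎_)
open import Data.List using (List; _∷_)
open import Data.List.Membership.Propositional using (_∈_)
open import Relation.Nullary using (¬_)
open import Relation.Binary.PropositionalEquality using (_≡_)
open import Relation.Binary.Structures using (IsPartialOrder)
open import Function.Definitions using (Injective)

record FinPoset : Set₁ where
  field
    size : ℕ
    _≤P_ : Fin size → Fin size → Set
    isPartialOrder : IsPartialOrder _≡_ _≤P_
open FinPoset public

StrictP : (P : FinPoset) → Fin (size P) → Fin (size P) → Set
StrictP P p q = _≤P_ P p q × ¬ (p ≡ q)

-- P is realized by d linear orders, each given as an injective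
-- ranking Fin (size P) → ℕ:  p <_P q  iff  π_i p < π_i q for all i.
Realizer : (P : FinPoset) → ℕ → Set
Realizer P d =
  Σ (Fin d → Fin (size P) → ℕ) λ π →
    ((i : Fin d) → Injective _≡_ _≡_ (π i)) ×
    ((p q : Fin (size P)) →
       (StrictP P p q → (i : Fin d) → π i p < π i q) ×
       (((i : Fin d) → π i p < π i q) → StrictP P p q))

-- dimension exactly 2: realizable by 2 linear orders but not by 1
-- (dimension = least such d, so we also exclude d = 0 explicitly).
HasDimension2 : FinPoset → Set
HasDimension2 P = Realizer P 2 × ¬ Realizer P 1 × ¬ Realizer P 0

Grid : ℕ → ℕ → Set
Grid k l = Fin k × Fin l

_≤G_ : {k l : ℕ} → Grid k l → Grid k l → Set
(a , b) ≤G (c , d) = (a F.≤ c) × (b F.≤ d)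

Adjacent1 : {m : ℕ} → Fin m → Fin m → Set
Adjacent1 x y = (suc (toℕ x) ≡ toℕ y) ⊎ (suc (toℕ y) ≡ toℕ x)

Neighboring : {k l : ℕ} → Grid k l → Grid k l → Set
Neighboring (a , b) (c , d) =
  ((a ≡ c) × Adjacent1 b d) ⊎ ((b ≡ d) × Adjacent1 a c)

StrongEmbedding : (P : FinPoset) (k l : ℕ) → (Fin (size P) → Grid k l) → Set
StrongEmbedding P k l e =
  Injective _≡_ _≡_ e ×
  ((p q : Fin (size P)) → (_≤P_ P p q → e p ≤G e q) × (e p ≤G e q → _≤P_ P p q))

ContainsStrongCopy : (P : FinPoset) (k l : ℕ) → List (Grid k l) → Set
ContainsStrongCopy P k l S =
  Σ (Fin (size P) → Grid k l) λ e → StrongEmbedding P k l e × ((p : Fin (size P)) → e p ∈ S)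

StrongSaturated : (P : FinPoset) (k l : ℕ) → List (Grid k l) → Set
StrongSaturated P k l F =
  ¬ ContainsStrongCopy P k l F ×
  ((x : Grid k l) → ¬ (x ∈ F) → ContainsStrongCopy P k l (x ∷ F))

NoNeighborsInCopies : FinPoset → Set
NoNeighborsInCopies P =
  (k l : ℕ) (e : Fin (size P) → Grid k l) → StrongEmbedding P k l e →
  (p q : Fin (size P)) → ¬ Neighboring (e p) (e q)

-- A point x outside a saturated family F whose comparisons with F (away from its grid
-- neighbours) agree with those of some c ∈ F is impossible: F ∪ {x} contains a copy of P,
-- and since copies avoid neighbouring points, replacing x by c gives a copy inside F.
-- If row n were empty while row n+1 is not, the point of row n next to the leftmost
-- point of row n+1 would be such an x (symmetrically with the rightmost point when row
-- n+1 is empty). Hence an empty row forces all rows to be empty, which a saturated family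
-- cannot be once P has two distinct elements; so F meets all k rows, and by transposition
-- all l columns.
module Submission where

open import Defs
open import Data.Nat using (ℕ; zero; suc; _≤_; _<_; _⊔_; _≟_; s≤s⁻¹; NonZero; >-nonZero⁻¹)
open import Data.List using (List; []; _∷_; length; filter; lookup)
import Data.Nat.Properties as ℕ
open import Data.Fin as Fin using (Fin; toℕ; fromℕ<)
open import Data.Fin.Properties using (toℕ-injective; toℕ-fromℕ<; toℕ<n; injective⇒≤)
open import Data.Product using (∃; _×_; _,_; proj₁; proj₂; swap; map)
open import Data.Product.Properties using (≡-dec)
open import Data.Product.Function.NonDependent.Propositional using (_×-⇔_)
open import Data.Sum using (_⊎_; inj₁; inj₂)
open import Data.Empty using (⊥; ⊥-elim)
import Data.List as List
open import Data.List.Relation.Unary.Unique.Propositional using (Unique)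
open import Data.List.Relation.Unary.Any as Any using (here; there)
open import Data.List.Relation.Unary.Any.Properties using (lookup-index)
open import Data.List.Membership.Propositional using (_∈_; lose)
open import Data.List.Membership.Propositional.Properties using (∈-map⁺; ∈-map⁻; ∈-filter⁺; ∈-filter⁻)
open import Data.List.Properties using (length-map)
open import Data.List.Extrema.Nat using (argmin; argmax; argmin-sel; argmax-sel; f[argmin]≤v⁺; v≤f[argmax]⁺)
open import Function using (_∘_; _⇔_; mk⇔; Equivalence; Injective)
open import Function.Properties.Equivalence using () renaming (refl to ⇔-refl; sym to ⇔-sym)
open import Relation.Binary using (DecidableEquality)
open import Relation.Nullary using (¬_; yes; no; Irrelevant)
open import Relation.Nullary.Decidable using (decidable-stable)
open import Relation.Unary using (Decidable)
open import Relation.Binary.PropositionalEquality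

open Equivalence using (to; from)

private
  variable
    k l : ℕ

m≤n⇔m≤n′ : ∀ {m n n′} → n′ ≡ suc n → m ≢ n′ → (m ≤ n) ⇔ (m ≤ n′)
m≤n⇔m≤n′ refl m≢n′ = mk⇔ ℕ.m≤n⇒m≤1+n (λ m≤n′ → s≤s⁻¹ (ℕ.≤∧≢⇒< m≤n′ m≢n′))

n≤m⇔n′≤m : ∀ {m n n′} → n′ ≡ suc n → m ≢ n → (n ≤ m) ⇔ (n′ ≤ m)
n≤m⇔n′≤m refl m≢n = mk⇔ (λ n≤m → ℕ.≤∧≢⇒< n≤m (m≢n ∘ sym)) ℕ.<⇒≤

module _ {A : Set} {Q : A → Set} (Q? : Decidable Q) (f : A → ℕ) {xs : List A} {x : A}
         (x∈xs : x ∈ xs) (Qx : Q x) where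

  private
    selected : ∀ {m} → m ≡ x ⊎ m ∈ filter Q? xs → m ∈ xs × Q m
    selected (inj₁ refl) = x∈xs , Qx
    selected (inj₂ m∈) = ∈-filter⁻ Q? m∈

  ∃-minimal : ∃ λ m → (m ∈ xs × Q m) × (∀ {y} → y ∈ xs → Q y → f m ≤ f y)
  ∃-minimal =
    argmin f x (filter Q? xs) , selected (argmin-sel f x (filter Q? xs)) ,
    λ y∈xs Qy → f[argmin]≤v⁺ x (filter Q? xs) (inj₂ (lose (∈-filter⁺ Q? y∈xs Qy) ℕ.≤-refl))

  ∃-maximal : ∃ λ m → (m ∈ xs × Q m) × (∀ {y} → y ∈ xs → Q y → f y ≤ f m)
  ∃-maximal =
    argmax f x (filter Q? xs) , selected (argmax-sel f x (filter Q? xs)) ,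
    λ y∈xs Qy → v≤f[argmax]⁺ x (filter Q? xs) (inj₂ (lose (∈-filter⁺ Q? y∈xs Qy) ℕ.≤-refl))

covering⇒≤length : {L : List (Fin k)} → (∀ i → i ∈ L) → k ≤ length L
covering⇒≤length {L = L} covers = injective⇒≤ index-injective
  where
  open ≡-Reasoning
  index-injective : Injective _≡_ _≡_ (Any.index ∘ covers)
  index-injective {i} {j} eq = begin
    i                               ≡⟨ lookup-index (covers i) ⟩
    lookup L (Any.index (covers i)) ≡⟨ cong (lookup L) eq ⟩
    lookup L (Any.index (covers j)) ≡⟨ lookup-index (covers j) ⟨
    j                               ∎

row col : Grid k l → ℕ
row = toℕ ∘ proj₁
col = toℕ ∘ proj₂

_≟G_ : DecidableEquality (Grid k l)
_≟G_ = ≡-dec Fin._≟_ Fin._≟_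

≤G-reflexive : {x y : Grid k l} → x ≡ y → x ≤G y
≤G-reflexive refl = ℕ.≤-refl , ℕ.≤-refl

≤G-antisym : {x y : Grid k l} → x ≤G y → y ≤G x → x ≡ y
≤G-antisym (i≤i′ , j≤j′) (i′≤i , j′≤j) = cong₂ _,_ (toℕ-injective (ℕ.≤-antisym i≤i′ i′≤i))
                                                    (toℕ-injective (ℕ.≤-antisym j≤j′ j′≤j))

SameComparisons : Grid k l → Grid k l → Grid k l → Set
SameComparisons d x y = (d ≤G x ⇔ d ≤G y) × (x ≤G d ⇔ y ≤G d)

SameComparisons-sym : {d x y : Grid k l} → SameComparisons d x y → SameComparisons d y x
SameComparisons-sym = map ⇔-sym ⇔-sym

adjacentRows-sameComparisons : ∀ {n} {i i′ : Fin k} {j : Fin l} {d} → toℕ i ≡ n → toℕ i′ ≡ suc n →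
  row d ≢ n → row d ≢ suc n → SameComparisons d (i , j) (i′ , j)
adjacentRows-sameComparisons refl i′≡ d≢n d≢1+n =
  (m≤n⇔m≤n′ i′≡ (λ e → d≢1+n (trans e i′≡)) ×-⇔ ⇔-refl) ,
  (n≤m⇔n′≤m i′≡ d≢n ×-⇔ ⇔-refl)

rightOf-sameComparisons : {d x y : Grid k l} → col x < col d → col y < col d →
  row x ≤ row d → row y ≤ row d → SameComparisons d x y
rightOf-sameComparisons x<d y<d x≤d y≤d =
  mk⇔ (λ d≤x → ⊥-elim (ℕ.<⇒≱ x<d (proj₂ d≤x))) (λ d≤y → ⊥-elim (ℕ.<⇒≱ y<d (proj₂ d≤y))) ,
  mk⇔ (λ _ → y≤d , ℕ.<⇒≤ y<d) (λ _ → x≤d , ℕ.<⇒≤ x<d)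

leftOf-sameComparisons : {d x y : Grid k l} → col d < col x → col d < col y →
  row d ≤ row x → row d ≤ row y → SameComparisons d x y
leftOf-sameComparisons d<x d<y d≤x d≤y =
  mk⇔ (λ _ → d≤y , ℕ.<⇒≤ d<y) (λ _ → d≤x , ℕ.<⇒≤ d<x) ,
  mk⇔ (λ x≤d → ⊥-elim (ℕ.<⇒≱ d<x (proj₂ x≤d))) (λ y≤d → ⊥-elim (ℕ.<⇒≱ d<y (proj₂ y≤d)))

replace : Grid k l → Grid k l → Grid k l → Grid k l
replace x x′ c with c ≟G x
... | yes _ = x′
... | no _ = c

module _ {F : List (Grid k l)} {x x′ : Grid k l} (x′∈F : x′ ∈ F)
         (alike : ∀ {d} → d ∈ F → ¬ Neighboring x d → SameComparisons d x x′) where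

  replace-∈ : ∀ {c} → c ∈ x ∷ F → replace x x′ c ∈ F
  replace-∈ {c} c∈ with c ≟G x
  ... | yes _ = x′∈F
  ... | no c≢x = Any.tail c≢x c∈

  replace-≤G : ∀ {c d} → c ∈ x ∷ F → d ∈ x ∷ F → ¬ Neighboring c d → ¬ Neighboring d c →
               (replace x x′ c ≤G replace x x′ d) ⇔ (c ≤G d)
  replace-≤G {c} {d} c∈ d∈ c≁d d≁c with c ≟G x | d ≟G x
  ... | yes refl | yes refl = mk⇔ (λ _ → ≤G-reflexive refl) (λ _ → ≤G-reflexive refl)
  ... | yes refl | no d≢x   = ⇔-sym (proj₂ (alike (Any.tail d≢x d∈) c≁d))
  ... | no c≢x   | yes refl = ⇔-sym (proj₁ (alike (Any.tail c≢x c∈) d≁c))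
  ... | no _     | no _     = ⇔-refl

  copy-replace : (P : FinPoset) → NoNeighborsInCopies P →
                 ContainsStrongCopy P k l (x ∷ F) → ContainsStrongCopy P k l F
  copy-replace P noNeighbors (e , emb@(e-inj , e-ord) , e∈) =
    replace x x′ ∘ e , (inj , ord) , replace-∈ ∘ e∈
    where
    ≤G-iff : ∀ p q → (replace x x′ (e p) ≤G replace x x′ (e q)) ⇔ (e p ≤G e q)
    ≤G-iff p q = replace-≤G (e∈ p) (e∈ q) (noNeighbors k l e emb p q) (noNeighbors k l e emb q p)

    inj : Injective _≡_ _≡_ (replace x x′ ∘ e)
    inj {p} {q} eq = e-inj (≤G-antisym (to (≤G-iff p q) (≤G-reflexive eq))
                                       (to (≤G-iff q p) (≤G-reflexive (sym eq))))

    ord : ∀ p q → (_≤P_ P p q → replace x x′ (e p) ≤G replace x x′ (e q)) ×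
                  (replace x x′ (e p) ≤G replace x x′ (e q) → _≤P_ P p q)
    ord p q = from (≤G-iff p q) ∘ proj₁ (e-ord p q) , proj₂ (e-ord p q) ∘ to (≤G-iff p q)

irrelevant⇒realizer₁ : (P : FinPoset) → Irrelevant (Fin (size P)) → Realizer P 1
irrelevant⇒realizer₁ P irrelevant =
  (λ _ _ → 0) , (λ _ {p} {q} _ → irrelevant p q) ,
  λ p q → (λ p<q → ⊥-elim (proj₂ p<q (irrelevant p q))) , (λ 0<0 → ⊥-elim (ℕ.n≮n 0 (0<0 Fin.zero)))

saturated-nonempty : (P : FinPoset) → ¬ Irrelevant (Fin (size P)) → Grid k l →
  {F : List (Grid k l)} → StrongSaturated P k l F → ∃ (_∈ F)
saturated-nonempty _ _ _ {d ∷ _} _ = d , here refl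
saturated-nonempty P nontrivial x {[]} (_ , extend) with extend x (λ ())
... | e , (e-inj , _) , e∈ = ⊥-elim (nontrivial λ p q → e-inj (trans (at-x p) (sym (at-x q))))
  where
  at-x : ∀ p → e p ≡ x
  at-x p with e∈ p
  ... | here ep≡x = ep≡x

RowEmpty : List (Grid k l) → ℕ → Set
RowEmpty F n = ∀ {d} → d ∈ F → row d ≢ n

module Saturated (P : FinPoset) (noNeighbors : NoNeighborsInCopies P) {k l : ℕ}
                 {F : List (Grid k l)} (saturated : StrongSaturated P k l F) where

  no-mimic : ∀ {x c} → ¬ x ∈ F → c ∈ F →
             (∀ {d} → d ∈ F → ¬ Neighboring x d → SameComparisons d x c) → ⊥
  no-mimic x∉F c∈F alike = proj₁ saturated (copy-replace c∈F alike P noNeighbors (proj₂ saturated _ x∉F))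

  emptyRow-suc : ∀ {n} → suc n < k → RowEmpty F n → RowEmpty F (suc n)
  emptyRow-suc {n} 1+n<k empty {d₀} d₀∈F d₀-row
    with ∃-minimal (λ d → row d ≟ suc n) col d₀∈F d₀-row
  ... | c , (c∈F , c-row) , leftmost = no-mimic x∉F c∈F alike
    where
    x : Grid k l
    x = fromℕ< (ℕ.<⇒≤ 1+n<k) , proj₂ c

    x-row : row x ≡ n
    x-row = toℕ-fromℕ< _

    x∉F : ¬ x ∈ F
    x∉F x∈F = empty x∈F x-row

    alike : ∀ {d} → d ∈ F → ¬ Neighboring x d → SameComparisons d x c
    alike {d} d∈F x≁d with row d ≟ suc n
    ... | no d≢1+n = adjacentRows-sameComparisons x-row c-row (empty d∈F) d≢1+n
    ... | yes d-row = rightOf-sameComparisons c<d c<d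
                        (subst₂ _≤_ (sym x-row) (sym d-row) (ℕ.n≤1+n n))
                        (ℕ.≤-reflexive (trans c-row (sym d-row)))
      where
      c<d : col c < col d
      c<d = ℕ.≤∧≢⇒< (leftmost d∈F d-row)
              (λ same → x≁d (inj₂ (toℕ-injective same , inj₁ (trans (cong suc x-row) (sym d-row)))))

  emptyRow-pred : ∀ {n} → suc n < k → RowEmpty F (suc n) → RowEmpty F n
  emptyRow-pred {n} 1+n<k empty {d₀} d₀∈F d₀-row
    with ∃-maximal (λ d → row d ≟ n) col d₀∈F d₀-row
  ... | c , (c∈F , c-row) , rightmost = no-mimic x∉F c∈F alike
    where
    x : Grid k l
    x = fromℕ< 1+n<k , proj₂ c

    x-row : row x ≡ suc n
    x-row = toℕ-fromℕ< _

    x∉F : ¬ x ∈ F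
    x∉F x∈F = empty x∈F x-row

    alike : ∀ {d} → d ∈ F → ¬ Neighboring x d → SameComparisons d x c
    alike {d} d∈F x≁d with row d ≟ n
    ... | no d≢n = SameComparisons-sym (adjacentRows-sameComparisons c-row x-row d≢n (empty d∈F))
    ... | yes d-row = leftOf-sameComparisons d<c d<c
                        (subst₂ _≤_ (sym d-row) (sym x-row) (ℕ.n≤1+n n))
                        (ℕ.≤-reflexive (trans d-row (sym c-row)))
      where
      d<c : col d < col c
      d<c = ℕ.≤∧≢⇒< (rightmost d∈F d-row)
              (λ same → x≁d (inj₂ (toℕ-injective (sym same) , inj₂ (trans (cong suc d-row) (sym x-row)))))

  emptyRow-toZero : ∀ {n} → n < k → RowEmpty F n → RowEmpty F 0
  emptyRow-toZero {zero} _ empty = empty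
  emptyRow-toZero {suc n} 1+n<k empty = emptyRow-toZero (ℕ.<⇒≤ 1+n<k) (emptyRow-pred 1+n<k empty)

  emptyRow-fromZero : ∀ {n} → n < k → RowEmpty F 0 → RowEmpty F n
  emptyRow-fromZero {zero} _ empty = empty
  emptyRow-fromZero {suc n} 1+n<k empty = emptyRow-suc 1+n<k (emptyRow-fromZero (ℕ.<⇒≤ 1+n<k) empty)

  rows-occupied : Fin l → ¬ Irrelevant (Fin (size P)) → (i : Fin k) → i ∈ List.map proj₁ F
  rows-occupied j nontrivial i = decidable-stable (Any.any? (i Fin.≟_) (List.map proj₁ F)) λ i∉ →
    let d , d∈F = saturated-nonempty P nontrivial (i , j) saturated
    in emptyRow-fromZero (toℕ<n (proj₁ d)) (emptyRow-toZero (toℕ<n i) (row-empty i∉)) d∈F refl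
    where
    row-empty : ¬ i ∈ List.map proj₁ F → RowEmpty F (toℕ i)
    row-empty i∉ d∈F d-row = i∉ (subst (_∈ List.map proj₁ F) (toℕ-injective d-row) (∈-map⁺ proj₁ d∈F))

  k≤length : Fin l → ¬ Irrelevant (Fin (size P)) → k ≤ length F
  k≤length j nontrivial =
    subst (k ≤_) (length-map proj₁ F) (covering⇒≤length (rows-occupied j nontrivial))

transpose-copy : {P : FinPoset} {S : List (Grid k l)} {T : List (Grid l k)} →
  (∀ {y} → y ∈ S → swap y ∈ T) → ContainsStrongCopy P k l S → ContainsStrongCopy P l k T
transpose-copy S⊆T (e , (e-inj , e-ord) , e∈) =
  swap ∘ e , (e-inj ∘ cong swap , λ p q → map (swap ∘_) (_∘ swap) (e-ord p q)) , S⊆T ∘ e∈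

transpose-saturated : {P : FinPoset} {F : List (Grid k l)} →
  StrongSaturated P k l F → StrongSaturated P l k (List.map swap F)
transpose-saturated {P = P} {F} (noCopy , extend) =
  noCopy ∘ transpose-copy {P = P} unswap ,
  λ x x∉ → transpose-copy {P = P} swap-∷ (extend (swap x) (x∉ ∘ ∈-map⁺ swap))
  where
  unswap : ∀ {y} → y ∈ List.map swap F → swap y ∈ F
  unswap y∈ with ∈-map⁻ swap y∈
  ... | c , c∈F , refl = c∈F

  swap-∷ : ∀ {x y} → y ∈ swap x ∷ F → swap y ∈ x ∷ List.map swap F
  swap-∷ (here refl) = here refl
  swap-∷ (there y∈F) = there (∈-map⁺ swap y∈F)

theorem1p10 : (P : FinPoset) → HasDimension2 P → NoNeighborsInCopies P →
    (k l : ℕ) → NonZero k → NonZero l →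
    (F : List (Grid k l)) → Unique F → StrongSaturated P k l F →
    k ⊔ l ≤ length F
theorem1p10 P (_ , ¬realizer₁ , _) noNeighbors k l k≢0 l≢0 F _ saturated =
  ℕ.⊔-lub (Saturated.k≤length P noNeighbors saturated some-column nontrivial)
          (subst (l ≤_) (length-map swap F)
            (Saturated.k≤length P noNeighbors (transpose-saturated {P = P} saturated) some-row nontrivial))
  where
  nontrivial : ¬ Irrelevant (Fin (size P))
  nontrivial = ¬realizer₁ ∘ irrelevant⇒realizer₁ P

  some-row : Fin k
  some-row = fromℕ< (>-nonZero⁻¹ k ⦃ k≢0 ⦄)

  some-column : Fin l
  some-column = fromℕ< (>-nonZero⁻¹ l ⦃ l≢0 ⦄)
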